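{- Let $n,k,r$ be positive integers with $r\le k$, and let $\mathcal{F}=\mathcal{F}(n,k,r)$ be the $r$-uniform hypergraph with vertex set $[k]^n$ whose edges are the $r$-element sets of points lying on a common axis-parallel line, i.e. $r$ points of $[k]^n$ that agree in all but one coordinate. Let $\gamma>10r/k$ and let $T\subseteq V(\mathcal{F})$ with $|T|>\gamma\,|V(\mathcal{F})|$. Then $$e(\mathcal{F}[T])\ge (\gamma-r/k)^r\,e(\mathcal{F}).$$
   Context: $[k]=\{1,\dots,k\}$; $\mathcal{F}[T]$ is the subhypergraph induced by $T$ and $e(\cdot)$ is the number of edges.
   Formalization: The parameter γ ranges over the rationals. -}

module Defs where

open import Data.Nat using (ℕ; zero; suc)
open import Data.Fin using (Fin)
open import Data.Fin.Properties using (all?) renaming (_≟_ to _≟ᶠ_)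
open import Data.Vec using (Vec; []; _∷_; lookup)
open import Data.List using (List; []; _∷_; length; concatMap; map; filter; allFin; _++_)
open import Data.List.Relation.Unary.All as All using (All)
open import Data.List.Relation.Unary.Any as Any using (Any)
open import Data.Bool using (Bool; T)
open import Data.Bool.Properties using (T?)
open import Data.Product using (_×_)
open import Relation.Binary.PropositionalEquality using (_≡_)
open import Relation.Nullary using (¬_; Dec; yes; no)
open import Relation.Nullary.Decidable using (_×-dec_; _→-dec_; ¬?)
open import Data.Nat.Properties using () renaming (_≟_ to _≟ℕ_)
open import Data.Rational using (ℚ; 1ℚ; _*_)

-- Points of [k]^n, represented as vectors of length n over Fin k
-- (Fin k stands for [k] = {1,...,k}).
Point : ℕ → ℕ → Set
Point n k = Vec (Fin k) n

allPoints : (n k : ℕ) → List (Point n k)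
allPoints zero    k = [] ∷ []
allPoints (suc n) k = concatMap (λ a → map (a ∷_) (allPoints n k)) (allFin k)

-- All sublists of a list; for a duplicate-free list these correspond
-- bijectively to the subsets of its underlying set.
sublists : {A : Set} → List A → List (List A)
sublists []       = [] ∷ []
sublists (x ∷ xs) = sublists xs ++ map (x ∷_) (sublists xs)

AgreeOff : {n k : ℕ} → Fin n → Point n k → Point n k → Set
AgreeOff {n} i p q = (j : Fin n) → ¬ (j ≡ i) → lookup p j ≡ lookup q j

OnAxisLine : {n k : ℕ} → List (Point n k) → Set
OnAxisLine {n} S = Any (λ i → All (λ p → All (λ q → AgreeOff i p q) S) S) (allFin n)

VSubset : ℕ → ℕ → Set
VSubset n k = Point n k → Bool

IsEdgeIn : {n k : ℕ} → ℕ → VSubset n k → List (Point n k) → Set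
IsEdgeIn r Tset S = (length S ≡ r) × All (λ p → T (Tset p)) S × OnAxisLine S

agreeOff? : {n k : ℕ} (i : Fin n) (p q : Point n k) → Dec (AgreeOff i p q)
agreeOff? i p q = all? (λ j → ¬? (j ≟ᶠ i) →-dec (lookup p j ≟ᶠ lookup q j))

onAxisLine? : {n k : ℕ} (S : List (Point n k)) → Dec (OnAxisLine S)
onAxisLine? S = Any.any? (λ i → All.all? (λ p → All.all? (λ q → agreeOff? i p q) S) S) (allFin _)

isEdgeIn? : {n k : ℕ} (r : ℕ) (Tset : VSubset n k) (S : List (Point n k)) → Dec (IsEdgeIn r Tset S)
isEdgeIn? r Tset S = (length S ≟ℕ r) ×-dec (All.all? (λ p → T? (Tset p)) S ×-dec onAxisLine? S)

full : {n k : ℕ} → VSubset n k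
full _ = Data.Bool.true

card : {n k : ℕ} → VSubset n k → ℕ
card {n} {k} Tset = length (filter (λ p → T? (Tset p)) (allPoints n k))

eInduced : (n k r : ℕ) → VSubset n k → ℕ
eInduced n k r Tset = length (filter (isEdgeIn? r Tset) (sublists (allPoints n k)))

eF : (n k r : ℕ) → ℕ
eF n k r = eInduced n k r full

_^ℚ_ : ℚ → ℕ → ℚ
q ^ℚ zero  = 1ℚ
q ^ℚ suc m = q * (q ^ℚ m)

module Submission where

-- Let K = k^(n-1) be the number of lines in each of the n directions.  For
-- r ≥ 2 every edge lies on exactly one line, so
--     e(F[T]) = Σ_directions Σ_lines C(|T ∩ line|, r),    e(F) = n·K·C(k, r).
-- As t ↦ C(t, r) is convex, its tangent at m = ⌊|T|/K⌋ gives, in each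
-- direction, Σ_lines C(|T ∩ line|, r) ≥ K·C(m, r), because the line sizes add
-- up to |T| ≥ K·m.  With C(k, r)·(m+1-r)^r ≤ C(m, r)·k^r this yields the
-- natural-number inequality (m+1-r)^r · e(F) ≤ e(F[T]) · k^r (for r = 1 it is
-- immediate, edges being singletons).  Finally |T| > γ·K·k gives
-- 0 ≤ (γ - r/k)·k ≤ m+1-r, which converts it into the rational statement.

module Counting where

  open import Data.Nat using (ℕ; suc; _+_; _*_; _≤_; z≤n)
  open import Data.Nat.Properties using (+-suc; +-mono-≤)
  open import Data.List using (List; []; _∷_; _++_; map; filter; length; concatMap)
  open import Data.List.Properties using (length-++; filter-++; filter-none; filter-all)
  open import Data.Nat.ListAction using (sum)
  open import Data.List.Membership.Propositional using (_∈_; find)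
  open import Data.List.Relation.Unary.Any as Any using (Any; here; there)
  open import Data.List.Relation.Unary.All as All using (All)
  open import Data.List.Relation.Unary.Unique.Propositional using (Unique)
  open import Data.List.Relation.Unary.AllPairs using (_∷_)
  open import Data.Product using (_,_)
  open import Data.Sum using (_⊎_; inj₁; inj₂)
  open import Data.Empty using (⊥-elim)
  open import Relation.Nullary using (¬_; yes; no)
  open import Relation.Unary using (Decidable)
  open import Relation.Binary.PropositionalEquality using (_≡_; refl; sym; trans; cong; cong₂)
  open import Function using (_∘_; id; _⇔_; Equivalence; mk⇔)

  count : {A : Set} {P : A → Set} → Decidable P → List A → ℕ
  count P? xs = length (filter P? xs)

  module _ {A : Set} {P : A → Set} (P? : Decidable P) where

    count-++ : (xs ys : List A) → count P? (xs ++ ys) ≡ count P? xs + count P? ys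
    count-++ xs ys = trans (cong length (filter-++ P? xs ys)) (length-++ (filter P? xs))

    count-none : (xs : List A) → (∀ x → x ∈ xs → ¬ P x) → count P? xs ≡ 0
    count-none xs h = cong length (filter-none P? (All.tabulate (h _)))

    count-all : (xs : List A) → (∀ x → P x) → count P? xs ≡ length xs
    count-all xs h = cong length (filter-all P? {xs} (All.tabulate (λ {x} _ → h x)))

    count-concatMap : {I : Set} (f : I → List A) (is : List I) →
      count P? (concatMap f is) ≡ sum (map (count P? ∘ f) is)
    count-concatMap f []       = refl
    count-concatMap f (i ∷ is) =
      trans (count-++ (f i) _) (cong (count P? (f i) +_) (count-concatMap f is))

  module _ {I : Set} (f : I → ℕ) (c : ℕ) where

    sum-map-const : (is : List I) → (∀ i → f i ≡ c) → sum (map f is) ≡ length is * c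
    sum-map-const []       h = refl
    sum-map-const (i ∷ is) h = cong₂ _+_ (h i) (sum-map-const is h)

    sum-map-lower : (is : List I) → (∀ i → c ≤ f i) → length is * c ≤ sum (map f is)
    sum-map-lower []       h = z≤n
    sum-map-lower (i ∷ is) h = +-mono-≤ (h i) (sum-map-lower is h)

  module _ {A B : Set} {P : B → Set} (P? : Decidable P) where

    count-map : (f : A → B) (xs : List A) → count P? (map f xs) ≡ count (P? ∘ f) xs
    count-map f []       = refl
    count-map f (x ∷ xs) with P? (f x)
    ... | yes _ = cong suc (count-map f xs)
    ... | no  _ = count-map f xs

  module _ {A : Set} {P Q : A → Set} (P? : Decidable P) (Q? : Decidable Q) where

    count-cong : (xs : List A) → (∀ x → x ∈ xs → P x ⇔ Q x) → count P? xs ≡ count Q? xs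
    count-cong []       h = refl
    count-cong (x ∷ xs) h with P? x | Q? x
    ... | yes _ | yes _ = cong suc (count-cong xs (λ y → h y ∘ there))
    ... | no  _ | no  _ = count-cong xs (λ y → h y ∘ there)
    ... | yes p | no ¬q = ⊥-elim (¬q (Equivalence.to   (h x (here refl)) p))
    ... | no ¬p | yes q = ⊥-elim (¬p (Equivalence.from (h x (here refl)) q))

  module _ {A : Set} {P Q R : A → Set} (P? : Decidable P) (Q? : Decidable Q) (R? : Decidable R) where

    count-⊎ : (xs : List A) → (∀ x → x ∈ xs → P x ⇔ (Q x ⊎ R x)) → (∀ x → x ∈ xs → Q x → ¬ R x) →
      count P? xs ≡ count Q? xs + count R? xs
    count-⊎ []       h d = refl
    count-⊎ (x ∷ xs) h d with P? x | Q? x | R? x | count-⊎ xs (λ y → h y ∘ there) (λ y → d y ∘ there)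
    ... | _     | yes q | yes r | _  = ⊥-elim (d x (here refl) q r)
    ... | yes _ | yes _ | no  _ | ih = cong suc ih
    ... | yes _ | no  _ | yes _ | ih = trans (cong suc ih) (sym (+-suc _ _))
    ... | no  _ | no  _ | no  _ | ih = ih
    ... | yes p | no ¬q | no ¬r | _  with Equivalence.to (h x (here refl)) p
    ...   | inj₁ q = ⊥-elim (¬q q)
    ...   | inj₂ r = ⊥-elim (¬r r)
    count-⊎ (x ∷ xs) h d | no ¬p | yes q | no _ | _ = ⊥-elim (¬p (Equivalence.from (h x (here refl)) (inj₁ q)))
    count-⊎ (x ∷ xs) h d | no ¬p | no _ | yes r | _ = ⊥-elim (¬p (Equivalence.from (h x (here refl)) (inj₂ r)))

  module _ {I A : Set} {Q : I → A → Set} (Q? : ∀ i → Decidable (Q i)) where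

    count-Σ : {P : A → Set} (P? : Decidable P) (xs : List A) (is : List I) → Unique is →
      (∀ x → x ∈ xs → P x ⇔ Any (λ i → Q i x) is) →
      (∀ x → x ∈ xs → ∀ i j → Q i x → Q j x → i ≡ j) →
      count P? xs ≡ sum (map (λ i → count (Q? i) xs) is)
    count-Σ P? xs []       _          h e = count-none P? xs (λ x x∈ p → ¬Any[] (Equivalence.to (h x x∈) p))
      where ¬Any[] : ∀ {x} → ¬ Any (λ i → Q i x) []
            ¬Any[] ()
    count-Σ {P} P? xs (i ∷ is) (i∉ ∷ u) h e =
      trans (count-⊎ P? (Q? i) someOf? xs split disjoint)
            (cong (count (Q? i) xs +_) (count-Σ someOf? xs is u (λ x _ → mk⇔ id id) e))
      where
      someOf? : Decidable (λ x → Any (λ j → Q j x) is)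
      someOf? x = Any.any? (λ j → Q? j x) is
      split : ∀ x → x ∈ xs → P x ⇔ (Q i x ⊎ Any (λ j → Q j x) is)
      split x x∈ = mk⇔ (λ p → uncons (Equivalence.to (h x x∈) p))
                       (λ s → Equivalence.from (h x x∈) (recons s))
        where recons : Q i x ⊎ Any (λ j → Q j x) is → Any (λ j → Q j x) (i ∷ is)
              recons (inj₁ q) = here q
              recons (inj₂ a) = there a
              uncons : Any (λ j → Q j x) (i ∷ is) → Q i x ⊎ Any (λ j → Q j x) is
              uncons (here q)  = inj₁ q
              uncons (there a) = inj₂ a
      disjoint : ∀ x → x ∈ xs → Q i x → ¬ Any (λ j → Q j x) is
      disjoint x x∈ q a = let (j , j∈ , q') = find a in All.lookup i∉ j∈ (e x x∈ i j q q')

module Binomial where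

  open import Data.Nat using (ℕ; zero; suc; _+_; _*_; _∸_; _^_; _≤_; _≤′_; ≤′-reflexive; ≤′-step; z≤n)
  open import Data.Nat.Properties
  open import Data.Nat.Combinatorics using (_C_; nCk+nC[k+1]≡[n+1]C[k+1]; nC1≡n)
  open import Data.Nat.Tactic.RingSolver using (solve-∀)
  open import Data.Nat.ListAction using (sum)
  open import Data.List using (List; []; _∷_; map; length)
  open import Data.Sum using (inj₁; inj₂)
  open import Data.Product using (_,_)
  open import Relation.Binary.PropositionalEquality using (_≡_; refl; sym; trans; cong; cong₂)
  open ≤-Reasoning

  pascal : ∀ n r → suc n C suc r ≡ n C suc r + n C r
  pascal n r = trans (sym (nCk+nC[k+1]≡[n+1]C[k+1] n r)) (+-comm (n C r) _)

  C-mono-suc : ∀ n r → n C r ≤ suc n C r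
  C-mono-suc n zero    = ≤-refl
  C-mono-suc n (suc r) = ≤-trans (m≤m+n _ _) (≤-reflexive (sym (pascal n r)))

  C-mono : ∀ r {m n} → m ≤ n → m C r ≤ n C r
  C-mono r m≤n = go (≤⇒≤′ m≤n)
    where
    go : ∀ {m n} → m ≤′ n → m C r ≤ n C r
    go (≤′-reflexive refl) = ≤-refl
    go (≤′-step m≤′n)      = ≤-trans (go m≤′n) (C-mono-suc _ r)

  -- Going up from m by d steps gains at least d·C(m, s), since the increments
  -- C(j, s) of j ↦ C(j, s+1) are nondecreasing ...
  gain-above : ∀ m d s → m C suc s + d * (m C s) ≤ (m + d) C suc s
  gain-above m zero    s = ≤-reflexive (trans (+-identityʳ _) (cong (_C suc s) (sym (+-identityʳ m))))
  gain-above m (suc d) s = begin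
    m C suc s + suc d * (m C s)               ≡⟨ regroup (m C suc s) d (m C s) ⟩
    (m C suc s + d * (m C s)) + m C s         ≤⟨ +-mono-≤ (gain-above m d s) (C-mono s (m≤m+n m d)) ⟩
    (m + d) C suc s + (m + d) C s             ≡⟨ sym (pascal (m + d) s) ⟩
    suc (m + d) C suc s                       ≡⟨ cong (_C suc s) (sym (+-suc m d)) ⟩
    (m + suc d) C suc s                       ∎
    where regroup : ∀ a d c → a + (c + d * c) ≡ (a + d * c) + c
          regroup = solve-∀

  loss-below : ∀ t d s → (t + d) C suc s ≤ t C suc s + d * ((t + d) C s)
  loss-below t zero    s = ≤-reflexive (trans (cong (_C suc s) (+-identityʳ t)) (sym (+-identityʳ _)))
  loss-below t (suc d) s = begin
    (t + suc d) C suc s                                  ≡⟨ cong (_C suc s) (+-suc t d) ⟩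
    suc (t + d) C suc s                                  ≡⟨ pascal (t + d) s ⟩
    (t + d) C suc s + (t + d) C s                        ≤⟨ +-monoˡ-≤ _ (loss-below t d s) ⟩
    t C suc s + d * ((t + d) C s) + (t + d) C s          ≤⟨ +-mono-≤ (+-monoʳ-≤ (t C suc s) (*-monoʳ-≤ d grow)) grow ⟩
    t C suc s + d * ((t + suc d) C s) + (t + suc d) C s  ≡⟨ regroup (t C suc s) d ((t + suc d) C s) ⟩
    t C suc s + suc d * ((t + suc d) C s)                ∎
    where grow : (t + d) C s ≤ (t + suc d) C s
          grow = C-mono s (+-monoʳ-≤ t (n≤1+n d))
          regroup : ∀ a d c → a + d * c + c ≡ a + (c + d * c)
          regroup = solve-∀

  -- Convexity of t ↦ C(t, s+1): the graph lies above its tangent at m,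
  --   C(t, s+1) ≥ C(m, s+1) + (t - m)·C(m, s),
  -- written without subtraction.
  tangent : ∀ t m s → m C suc s + t * (m C s) ≤ t C suc s + m * (m C s)
  tangent t m s with ≤-total m t
  ... | inj₁ m≤t with m≤n⇒∃[o]m+o≡n m≤t
  ...   | d , refl = begin
    m C suc s + (m + d) * (m C s)          ≡⟨ regroup (m C suc s) m d (m C s) ⟩
    (m C suc s + d * (m C s)) + m * (m C s) ≤⟨ +-monoˡ-≤ _ (gain-above m d s) ⟩
    (m + d) C suc s + m * (m C s)          ∎
    where regroup : ∀ a m d c → a + (m + d) * c ≡ (a + d * c) + m * c
          regroup = solve-∀
  tangent t m s | inj₂ t≤m with m≤n⇒∃[o]m+o≡n t≤m
  ...   | d , refl = begin
    (t + d) C suc s + t * c                ≤⟨ +-monoˡ-≤ _ (loss-below t d s) ⟩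
    t C suc s + d * c + t * c              ≡⟨ regroup (t C suc s) d t c ⟩
    t C suc s + (t + d) * c                ∎
    where c : ℕ
          c = (t + d) C s
          regroup : ∀ a d t c → a + d * c + t * c ≡ a + (t + d) * c
          regroup = solve-∀

  jensen : {I : Set} (t : I → ℕ) (qs : List I) (m s : ℕ) →
    length qs * m ≤ sum (map t qs) →
    length qs * (m C suc s) ≤ sum (map (λ q → t q C suc s) qs)
  jensen t qs m s avg = +-cancelʳ-≤ (L * m * c′) _ _ (begin
    L * c + L * m * c′                            ≤⟨ +-monoʳ-≤ (L * c) (*-monoˡ-≤ c′ avg) ⟩
    L * c + sum (map t qs) * c′                   ≤⟨ summed qs ⟩
    sum (map (λ q → t q C suc s) qs) + L * m * c′ ∎)
    where
    L c c′ : ℕ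
    L  = length qs
    c  = m C suc s
    c′ = m C s
    summed : ∀ qs → length qs * c + sum (map t qs) * c′ ≤ sum (map (λ q → t q C suc s) qs) + length qs * m * c′
    summed []       = z≤n
    summed (q ∷ qs) = begin
      (c + length qs * c) + (t q + sum (map t qs)) * c′
        ≡⟨ regroup₁ c (length qs) (t q) (sum (map t qs)) c′ ⟩
      (c + t q * c′) + (length qs * c + sum (map t qs) * c′)
        ≤⟨ +-mono-≤ (tangent (t q) m s) (summed qs) ⟩
      (t q C suc s + m * c′) + (sum (map (λ q → t q C suc s) qs) + length qs * m * c′)
        ≡⟨ regroup₂ (t q C suc s) m c′ (sum (map (λ q → t q C suc s) qs)) (length qs) ⟩
      (t q C suc s + sum (map (λ q → t q C suc s) qs)) + suc (length qs) * m * c′ ∎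
      where regroup₁ : ∀ c L t S c′ → (c + L * c) + (t + S) * c′ ≡ (c + t * c′) + (L * c + S * c′)
            regroup₁ = solve-∀
            regroup₂ : ∀ a m c′ B L → (a + m * c′) + (B + L * m * c′) ≡ (a + B) + (1 + L) * m * c′
            regroup₂ = solve-∀

  absorption : ∀ n r → (suc n C suc r) * suc r ≡ suc n * (n C r)
  absorption zero    zero    = refl
  absorption zero    (suc r) = refl
  absorption (suc n) zero    = trans (*-identityʳ (suc (suc n) C 1)) (trans (nC1≡n (suc (suc n))) (sym (*-identityʳ (suc (suc n)))))
  absorption (suc n) (suc r) = begin-equality
    (suc (suc n) C suc (suc r)) * suc (suc r)
      ≡⟨ cong (_* suc (suc r)) (pascal (suc n) (suc r)) ⟩
    (a + b) * suc (suc r)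
      ≡⟨ regroup₁ a b r ⟩
    a * suc (suc r) + b * suc r + b
      ≡⟨ cong₂ (λ x y → x + y + b) (absorption n (suc r)) (absorption n r) ⟩
    suc n * (n C suc r) + suc n * (n C r) + b
      ≡⟨ regroup₂ n (n C suc r) (n C r) b ⟩
    b + suc n * (n C suc r + n C r)
      ≡⟨ cong (λ x → b + suc n * x) (sym (pascal n r)) ⟩
    suc (suc n) * b ∎
    where a b : ℕ
          a = suc n C suc (suc r)
          b = suc n C suc r
          regroup₁ : ∀ a b r → (a + b) * (2 + r) ≡ a * (2 + r) + b * (1 + r) + b
          regroup₁ = solve-∀
          regroup₂ : ∀ n x y b → (1 + n) * x + (1 + n) * y + b ≡ b + (1 + n) * (x + y)
          regroup₂ = solve-∀

  -- C(k, r)·(m+1-r)^r ≤ C(m, r)·k^r: comparing the falling factorials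
  -- (m+1-r)^r ≤ m(m-1)⋯(m-r+1) and k(k-1)⋯(k-r+1) ≤ k^r.
  binomial-ratio : ∀ r m k → (k C r) * (suc m ∸ r) ^ r ≤ (m C r) * k ^ r
  binomial-ratio zero    m       k       = ≤-refl
  binomial-ratio (suc s) zero    k       = ≤-reflexive (trans (cong (λ x → (k C suc s) * (x * x ^ s)) (0∸n≡0 s)) (*-zeroʳ (k C suc s)))
  binomial-ratio (suc s) (suc m) zero    = z≤n
  binomial-ratio (suc s) (suc m) (suc k) = *-cancelʳ-≤ _ _ (suc s) (begin
    (suc k C suc s) * (M * M ^ s) * suc s   ≡⟨ regroup₁ (suc k C suc s) M (M ^ s) (suc s) ⟩
    ((suc k C suc s) * suc s) * (M * M ^ s) ≡⟨ cong (_* (M * M ^ s)) (absorption k s) ⟩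
    suc k * (k C s) * (M * M ^ s)           ≡⟨ regroup₂ (suc k) (k C s) M (M ^ s) ⟩
    suc k * M * ((k C s) * M ^ s)           ≤⟨ *-mono-≤ (*-monoʳ-≤ (suc k) (m∸n≤m (suc m) s)) (binomial-ratio s m k) ⟩
    suc k * suc m * ((m C s) * k ^ s)       ≤⟨ *-monoʳ-≤ (suc k * suc m) (*-monoʳ-≤ (m C s) (^-monoˡ-≤ s (n≤1+n k))) ⟩
    suc k * suc m * ((m C s) * suc k ^ s)   ≡⟨ regroup₃ (suc k) (suc m) (m C s) (suc k ^ s) ⟩
    suc m * (m C s) * (suc k * suc k ^ s)   ≡⟨ cong (_* (suc k * suc k ^ s)) (sym (absorption m s)) ⟩
    (suc m C suc s) * suc s * (suc k * suc k ^ s) ≡⟨ regroup₄ (suc m C suc s) (suc s) (suc k) (suc k ^ s) ⟩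
    (suc m C suc s) * (suc k * suc k ^ s) * suc s ∎)
    where
    M : ℕ
    M = suc m ∸ s
    regroup₁ : ∀ a b c d → a * (b * c) * d ≡ (a * d) * (b * c)
    regroup₁ = solve-∀
    regroup₂ : ∀ a b c d → a * b * (c * d) ≡ a * c * (b * d)
    regroup₂ = solve-∀
    regroup₃ : ∀ a b c d → a * b * (c * d) ≡ b * c * (a * d)
    regroup₃ = solve-∀
    regroup₄ : ∀ a b c d → a * b * (c * d) ≡ a * (c * d) * b
    regroup₄ = solve-∀

module Sublists where

  open import Data.Nat using (ℕ; zero; suc; _+_; _≟_)
  open import Data.Nat.Properties using (+-identityʳ; suc-injective; +-commutativeSemigroup)
  open import Algebra.Properties.CommutativeSemigroup +-commutativeSemigroup using (interchange; xy∙z≈xz∙y)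
  open import Data.Nat.Combinatorics using (_C_)
  open import Data.List using (List; []; _∷_; _++_; map; length; concatMap)
  open import Data.Nat.ListAction using (sum)
  open import Data.List.Membership.Propositional using (_∈_; find)
  open import Data.List.Membership.Propositional.Properties using (∈-++⁻; ∈-++⁺ʳ; ∈-map⁻; ∈-concatMap⁻)
  open import Data.List.Relation.Unary.Any using (here; there)
  open import Data.List.Relation.Unary.All as All using (All; _∷_)
  open import Data.List.Relation.Unary.Unique.Propositional using (Unique)
  open import Data.List.Relation.Unary.AllPairs using ([]; _∷_)
  open import Data.List.Relation.Binary.Sublist.Propositional using (_⊆_; []; _∷_; _∷ʳ_; lookup)
  open import Data.List.Relation.Binary.Sublist.Propositional.Properties using (All-resp-⊆)
  open import Data.List.Relation.Binary.Permutation.Propositional using (_↭_; refl; prep; swap; trans)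
  open import Data.Product using (_×_; _,_)
  open import Data.Sum using (inj₁; inj₂)
  open import Relation.Nullary using (¬_; yes; no; _×-dec_)
  open import Relation.Unary using (Decidable)
  open import Relation.Binary.PropositionalEquality as ≡ using (_≡_; _≢_; refl; sym; cong; cong₂)
  open import Function using (_∘_; mk⇔)
  open import Defs using (sublists)
  open Counting
  open Binomial using (pascal)
  open ≡.≡-Reasoning

  module _ {A : Set} where

    subcount : {P : List A → Set} → Decidable P → List A → ℕ
    subcount P? L = count P? (sublists L)

    subcount-∷ : {P : List A → Set} (P? : Decidable P) (x : A) (xs : List A) →
      subcount P? (x ∷ xs) ≡ subcount P? xs + subcount (P? ∘ (x ∷_)) xs
    subcount-∷ P? x xs = ≡.trans (count-++ P? (sublists xs) _)
      (cong (subcount P? xs +_) (count-map P? (x ∷_) (sublists xs)))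

    subcount-[] : {P : List A → Set} (P? : Decidable P) → ¬ P [] → subcount P? [] ≡ 0
    subcount-[] P? ¬p = count-none P? ([] ∷ []) (λ { _ (here refl) → ¬p })

    sublists⇒⊆ : {S xs : List A} → S ∈ sublists xs → S ⊆ xs
    sublists⇒⊆ {xs = []}     (here refl) = []
    sublists⇒⊆ {xs = x ∷ xs} S∈ with ∈-++⁻ (sublists xs) S∈
    ... | inj₁ S∈′ = x ∷ʳ sublists⇒⊆ S∈′
    ... | inj₂ S∈′ with ∈-map⁻ (x ∷_) S∈′
    ...   | _ , S∈″ , refl = refl ∷ sublists⇒⊆ S∈″

    unique-⊆ : {S xs : List A} → S ⊆ xs → Unique xs → Unique S
    unique-⊆ []         []         = []
    unique-⊆ (_ ∷ʳ τ)   (_ ∷ u)    = unique-⊆ τ u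
    unique-⊆ (refl ∷ τ) (x∉ ∷ u)   = All-resp-⊆ τ x∉ ∷ unique-⊆ τ u

    subcount-↭ : {P : List A → Set} (P? : Decidable P) → (∀ {S S′} → S ↭ S′ → P S → P S′) →
      {xs ys : List A} → xs ↭ ys → subcount P? xs ≡ subcount P? ys
    subcount-↭ P? inv refl = refl
    subcount-↭ P? inv {x ∷ xs} {x ∷ ys} (prep x p) = begin
      subcount P? (x ∷ xs)                          ≡⟨ subcount-∷ P? x xs ⟩
      subcount P? xs + subcount (P? ∘ (x ∷_)) xs     ≡⟨ cong₂ _+_ (subcount-↭ P? inv p) (subcount-↭ (P? ∘ (x ∷_)) (inv ∘ prep x) p) ⟩
      subcount P? ys + subcount (P? ∘ (x ∷_)) ys     ≡⟨ sym (subcount-∷ P? x ys) ⟩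
      subcount P? (x ∷ ys)                          ∎
    subcount-↭ {P} P? inv {x ∷ y ∷ xs} {y ∷ x ∷ ys} (swap x y p) = begin
      subcount P? (x ∷ y ∷ xs)                                ≡⟨ subcount-∷∷ P? x y xs ⟩
      (subcount P? xs + subcount Py? xs) + (subcount Px? xs + subcount Pxy? xs)
        ≡⟨ interchange (subcount P? xs) _ _ _ ⟩
      (subcount P? xs + subcount Px? xs) + (subcount Py? xs + subcount Pxy? xs)
        ≡⟨ cong₂ _+_ (cong₂ _+_ (subcount-↭ P? inv p) (subcount-↭ Px? (inv ∘ prep x) p))
                     (cong₂ _+_ (subcount-↭ Py? (inv ∘ prep y) p)
                                (≡.trans (subcount-↭ Pxy? (inv ∘ prep x ∘ prep y) p)
                                         (count-cong Pxy? Pyx? (sublists ys) (λ _ _ → mk⇔ (inv (swap x y refl)) (inv (swap y x refl)))))) ⟩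
      (subcount P? ys + subcount Px? ys) + (subcount Py? ys + subcount Pyx? ys)
        ≡⟨ sym (subcount-∷∷ P? y x ys) ⟩
      subcount P? (y ∷ x ∷ ys)                                ∎
      where
      Px?  : Decidable (P ∘ (x ∷_))
      Px?  = P? ∘ (x ∷_)
      Py?  : Decidable (P ∘ (y ∷_))
      Py?  = P? ∘ (y ∷_)
      Pxy? : Decidable (P ∘ (x ∷_) ∘ (y ∷_))
      Pxy? = Px? ∘ (y ∷_)
      Pyx? : Decidable (P ∘ (y ∷_) ∘ (x ∷_))
      Pyx? = Py? ∘ (x ∷_)
      subcount-∷∷ : ∀ {P : List A → Set} (P? : Decidable P) u v zs → subcount P? (u ∷ v ∷ zs) ≡
        (subcount P? zs + subcount (P? ∘ (v ∷_)) zs) + (subcount (P? ∘ (u ∷_)) zs + subcount ((P? ∘ (u ∷_)) ∘ (v ∷_)) zs)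
      subcount-∷∷ P? u v zs = ≡.trans (subcount-∷ P? u (v ∷ zs)) (cong₂ _+_ (subcount-∷ P? v zs) (subcount-∷ (P? ∘ (u ∷_)) v zs))
    subcount-↭ P? inv (trans p q) = ≡.trans (subcount-↭ P? inv p) (subcount-↭ P? inv q)

    subcount-inert : {P : List A → Set} (P? : Decidable P) (R : List A) →
      (∀ y t → (y ∷ t) ⊆ R → ¬ P (y ∷ t)) → subcount P? R ≡ subcount P? []
    subcount-inert P? []      h = refl
    subcount-inert P? (x ∷ R) h = begin
      subcount P? (x ∷ R)                        ≡⟨ subcount-∷ P? x R ⟩
      subcount P? R + subcount (P? ∘ (x ∷_)) R   ≡⟨ cong₂ _+_ (subcount-inert P? R (λ y t τ → h y t (x ∷ʳ τ)))
                                                      (count-none (P? ∘ (x ∷_)) (sublists R) (λ S S∈ → h x S (refl ∷ sublists⇒⊆ S∈))) ⟩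
      subcount P? [] + 0                         ≡⟨ +-identityʳ _ ⟩
      subcount P? []                             ∎

    subcount-++-inert : {P : List A → Set} (P? : Decidable P) (B R : List A) →
      (∀ s y t → s ⊆ B → (y ∷ t) ⊆ R → ¬ P (s ++ y ∷ t)) → subcount P? (B ++ R) ≡ subcount P? B
    subcount-++-inert P? []      R h = subcount-inert P? R (λ y t τ → h [] y t [] τ)
    subcount-++-inert P? (b ∷ B) R h = begin
      subcount P? (b ∷ B ++ R)                           ≡⟨ subcount-∷ P? b (B ++ R) ⟩
      subcount P? (B ++ R) + subcount (P? ∘ (b ∷_)) (B ++ R)
        ≡⟨ cong₂ _+_ (subcount-++-inert P? B R (λ s y t σ τ → h s y t (b ∷ʳ σ) τ))
                     (subcount-++-inert (P? ∘ (b ∷_)) B R (λ s y t σ τ → h (b ∷ s) y t (refl ∷ σ) τ)) ⟩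
      subcount P? B + subcount (P? ∘ (b ∷_)) B           ≡⟨ sym (subcount-∷ P? b B) ⟩
      subcount P? (b ∷ B)                                ∎

    subcount-++ : {P : List A → Set} (P? : Decidable P) (B R : List A) → ¬ P [] →
      (∀ x s y t → (x ∷ s) ⊆ B → (y ∷ t) ⊆ R → ¬ P (x ∷ s ++ y ∷ t)) →
      subcount P? (B ++ R) ≡ subcount P? B + subcount P? R
    subcount-++ P? []      R ¬p[] h = cong (_+ subcount P? R) (sym (subcount-[] P? ¬p[]))
    subcount-++ P? (b ∷ B) R ¬p[] h = begin
      subcount P? (b ∷ B ++ R)                                  ≡⟨ subcount-∷ P? b (B ++ R) ⟩
      subcount P? (B ++ R) + subcount (P? ∘ (b ∷_)) (B ++ R)
        ≡⟨ cong₂ _+_ (subcount-++ P? B R ¬p[] (λ x s y t σ τ → h x s y t (b ∷ʳ σ) τ))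
                     (subcount-++-inert (P? ∘ (b ∷_)) B R (λ s y t σ τ → h b s y t (refl ∷ σ) τ)) ⟩
      (subcount P? B + subcount P? R) + subcount (P? ∘ (b ∷_)) B ≡⟨ xy∙z≈xz∙y (subcount P? B) _ _ ⟩
      (subcount P? B + subcount (P? ∘ (b ∷_)) B) + subcount P? R ≡⟨ cong (_+ subcount P? R) (sym (subcount-∷ P? b B)) ⟩
      subcount P? (b ∷ B) + subcount P? R                       ∎

    subcount-blocks : {I : Set} (block : I → List A) {P : List A → Set} (P? : Decidable P)
      (Linked : A → A → Set) → ¬ P [] →
      (∀ S → P S → All (λ x → All (Linked x) S) S) →
      (∀ {i j x y} → i ≢ j → x ∈ block i → y ∈ block j → ¬ Linked x y) →
      (is : List I) → Unique is → subcount P? (concatMap block is) ≡ sum (map (subcount P? ∘ block) is)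
    subcount-blocks block P? Linked ¬p[] clique apart []       _        = subcount-[] P? ¬p[]
    subcount-blocks block {P} P? Linked ¬p[] clique apart (i ∷ is) (i∉ ∷ u) =
      ≡.trans (subcount-++ P? (block i) (concatMap block is) ¬p[] mixed)
              (cong (subcount P? (block i) +_) (subcount-blocks block P? Linked ¬p[] clique apart is u))
      where
      mixed : ∀ x s y t → (x ∷ s) ⊆ block i → (y ∷ t) ⊆ concatMap block is → ¬ P (x ∷ s ++ y ∷ t)
      mixed x s y t σ τ p with find (∈-concatMap⁻ block {xs = is} (lookup τ (here refl)))
      ... | j , j∈ , y∈ = apart (All.lookup i∉ j∈) (lookup σ (here refl)) y∈
                            (All.lookup (All.head (clique _ p)) (there (∈-++⁺ʳ s (here refl))))

  module _ {A : Set} {P : A → Set} (P? : Decidable P) where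

    Selection : ℕ → List A → Set
    Selection r S = length S ≡ r × All P S

    selection? : (r : ℕ) → Decidable (Selection r)
    selection? r S = (length S ≟ r) ×-dec All.all? P? S

    subcount-selection : (r : ℕ) (xs : List A) → subcount (selection? r) xs ≡ count P? xs C r
    subcount-selection zero    []       = refl
    subcount-selection (suc r) []       = refl
    subcount-selection r       (x ∷ xs) with P? x
    ... | no ¬p = begin
      subcount (selection? r) (x ∷ xs)                                   ≡⟨ subcount-∷ (selection? r) x xs ⟩
      subcount (selection? r) xs + subcount (selection? r ∘ (x ∷_)) xs
        ≡⟨ cong₂ _+_ (subcount-selection r xs) (count-none (selection? r ∘ (x ∷_)) (sublists xs) (λ { _ _ (_ , px ∷ _) → ¬p px })) ⟩
      count P? xs C r + 0                                                ≡⟨ +-identityʳ _ ⟩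
      count P? xs C r                                                    ∎
    ... | yes p with r
    ...   | zero = ≡.trans (subcount-∷ (selection? 0) x xs)
                     (cong₂ _+_ (subcount-selection 0 xs) (count-none (selection? 0 ∘ (x ∷_)) (sublists xs) (λ { _ _ (() , _) })))
    ...   | suc r′ = begin
      subcount (selection? (suc r′)) (x ∷ xs)
        ≡⟨ subcount-∷ (selection? (suc r′)) x xs ⟩
      subcount (selection? (suc r′)) xs + subcount (selection? (suc r′) ∘ (x ∷_)) xs
        ≡⟨ cong (subcount (selection? (suc r′)) xs +_) (count-cong (selection? (suc r′) ∘ (x ∷_)) (selection? r′) (sublists xs)
             (λ _ _ → mk⇔ (λ { (len , _ ∷ ps) → suc-injective len , ps }) (λ (len , ps) → cong suc len , p ∷ ps))) ⟩
      subcount (selection? (suc r′)) xs + subcount (selection? r′) xs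
        ≡⟨ cong₂ _+_ (subcount-selection (suc r′) xs) (subcount-selection r′ xs) ⟩
      count P? xs C suc r′ + count P? xs C r′                            ≡⟨ sym (pascal (count P? xs) r′) ⟩
      suc (count P? xs) C suc r′                                         ∎

module Lines where

  open import Data.Nat using (ℕ; zero; suc; _+_; _*_; _^_)
  open import Data.Fin using (Fin; zero; suc; punchIn)
  open import Data.Fin.Properties using (punchInᵢ≢i; punchIn-punchOut)
  open import Data.Vec using ([]; _∷_; lookup; insertAt)
  open import Data.Vec.Properties using (insertAt-punchIn; ∷-injective; tabulate∘lookup; tabulate-cong)
  open import Data.List using (List; []; _∷_; _++_; map; length; concatMap; allFin; cartesianProductWith)
  open import Data.List.Properties using (concatMap-++; concatMap-cong; concatMap-map; map-concatMap; map-∘; length-map; length-++; length-tabulate)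
  open import Data.List.Membership.Propositional using (_∈_)
  open import Data.List.Membership.Propositional.Properties using (∈-map⁻)
  open import Data.List.Relation.Unary.All using ([])
  open import Data.List.Relation.Unary.AllPairs using ([]; _∷_)
  open import Data.List.Relation.Unary.Unique.Propositional using (Unique)
  open import Data.List.Relation.Unary.Unique.Propositional.Properties using (allFin⁺; cartesianProductWith⁺)
  open import Data.List.Relation.Binary.Permutation.Propositional using (_↭_; prep; ↭-sym; ↭-reflexive) renaming (refl to ↭-refl; trans to ↭-trans)
  open import Data.List.Relation.Binary.Permutation.Propositional.Properties using (++⁺; ++⁺ˡ; shifts; map⁺)
  open import Data.Product using (_,_)
  open import Relation.Nullary using (¬_)
  open import Relation.Binary.PropositionalEquality as ≡ using (_≡_; _≢_; refl; sym; trans; cong; cong₂; subst)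
  open import Function using (_∘_)
  open import Defs

  module _ {A B : Set} where

    concatMap-concatMap : {C : Set} (f : B → List C) (g : A → List B) (xs : List A) →
      concatMap f (concatMap g xs) ≡ concatMap (concatMap f ∘ g) xs
    concatMap-concatMap f g []       = refl
    concatMap-concatMap f g (x ∷ xs) =
      trans (concatMap-++ f (g x) _) (cong (concatMap f (g x) ++_) (concatMap-concatMap f g xs))

    concatMap-↭ : {f g : A → List B} → (∀ x → f x ↭ g x) → (xs : List A) → concatMap f xs ↭ concatMap g xs
    concatMap-↭ h []       = ↭-refl
    concatMap-↭ h (x ∷ xs) = ++⁺ (h x) (concatMap-↭ h xs)

    concatMap-∷-↭ : (a : A → B) (b : A → List B) (ys : List A) →
      concatMap (λ y → a y ∷ b y) ys ↭ map a ys ++ concatMap b ys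
    concatMap-∷-↭ a b []       = ↭-refl
    concatMap-∷-↭ a b (y ∷ ys) =
      prep (a y) (↭-trans (++⁺ˡ (b y) (concatMap-∷-↭ a b ys)) (shifts (b y) (map a ys)))

  product-↭ : {A B C : Set} (h : A → B → C) (xs : List A) (ys : List B) →
    concatMap (λ x → map (h x) ys) xs ↭ concatMap (λ y → map (λ x → h x y) xs) ys
  product-↭ h []       ys = ↭-reflexive (sym (no-columns ys))
    where no-columns : ∀ ys → concatMap (λ y → map (λ x → h x y) []) ys ≡ []
          no-columns []       = refl
          no-columns (_ ∷ ys) = no-columns ys
  product-↭ h (x ∷ xs) ys = ↭-trans (++⁺ˡ (map (h x) ys) (product-↭ h xs ys))
    (↭-sym (concatMap-∷-↭ (h x) (λ y → map (λ x′ → h x′ y) xs) ys))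

  allPoints-unique : (n k : ℕ) → Unique (allPoints n k)
  allPoints-unique zero    k = [] ∷ []
  allPoints-unique (suc n) k = subst Unique (sym (as-product (allFin k)))
    (cartesianProductWith⁺ _∷_ ∷-injective (allFin⁺ k) (allPoints-unique n k))
    where as-product : ∀ as → concatMap (λ a → map (a ∷_) (allPoints n k)) as ≡ cartesianProductWith _∷_ as (allPoints n k)
          as-product []       = refl
          as-product (a ∷ as) = cong (map (a ∷_) (allPoints n k) ++_) (as-product as)

  length-allFin : (n : ℕ) → length (allFin n) ≡ n
  length-allFin n = length-tabulate {n = n} (λ i → i)

  length-allPoints : (n k : ℕ) → length (allPoints n k) ≡ k ^ n
  length-allPoints zero    k = refl
  length-allPoints (suc n) k = trans (by-first-coordinate (allFin k)) (cong (_* k ^ n) (length-allFin k))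
    where by-first-coordinate : ∀ as → length (concatMap (λ a → map (a ∷_) (allPoints n k)) as) ≡ length as * k ^ n
          by-first-coordinate []       = refl
          by-first-coordinate (a ∷ as) = trans (length-++ (map (a ∷_) (allPoints n k)))
            (cong₂ _+_ (trans (length-map (a ∷_) (allPoints n k)) (length-allPoints n k)) (by-first-coordinate as))

  points-ext : {n k : ℕ} (p q : Point n k) → (∀ j → lookup p j ≡ lookup q j) → p ≡ q
  points-ext p q h = trans (sym (tabulate∘lookup p)) (trans (tabulate-cong h) (tabulate∘lookup q))

  module _ {k : ℕ} where

    line : {n : ℕ} → Fin (suc n) → Point n k → List (Point (suc n) k)
    line i q = map (insertAt q i) (allFin k)

    allPoints-by-lines : (n : ℕ) (i : Fin (suc n)) → allPoints (suc n) k ↭ concatMap (line i) (allPoints n k)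
    allPoints-by-lines n       zero    = product-↭ _∷_ (allFin k) (allPoints n k)
    allPoints-by-lines (suc n) (suc j) =
      ↭-trans (concatMap-↭ (λ b → map⁺ (b ∷_) (allPoints-by-lines n j)) (allFin k)) (↭-reflexive (sym regroup))
      where
      open ≡.≡-Reasoning
      line-∷ : ∀ b q → line (suc j) (b ∷ q) ≡ map (b ∷_) (line j q)
      line-∷ b q = map-∘ (allFin k)
      regroup : concatMap (line (suc j)) (allPoints (suc n) k) ≡ concatMap (λ b → map (b ∷_) (concatMap (line j) (allPoints n k))) (allFin k)
      regroup = begin
        concatMap (line (suc j)) (concatMap (λ b → map (b ∷_) (allPoints n k)) (allFin k))
          ≡⟨ concatMap-concatMap (line (suc j)) _ (allFin k) ⟩
        concatMap (λ b → concatMap (line (suc j)) (map (b ∷_) (allPoints n k))) (allFin k)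
          ≡⟨ concatMap-cong (λ b → trans (concatMap-map (line (suc j)) (b ∷_) (allPoints n k))
                                  (trans (concatMap-cong (line-∷ b) (allPoints n k))
                                         (sym (map-concatMap (b ∷_) (line j) (allPoints n k))))) (allFin k) ⟩
        concatMap (λ b → map (b ∷_) (concatMap (line j) (allPoints n k))) (allFin k) ∎

    line-agree : {n : ℕ} (i : Fin (suc n)) (q : Point n k) {x y : Point (suc n) k} →
      x ∈ line i q → y ∈ line i q → AgreeOff i x y
    line-agree i q x∈ y∈ j j≢i with ∈-map⁻ (insertAt q i) x∈ | ∈-map⁻ (insertAt q i) y∈
    ... | a , _ , refl | b , _ , refl =
      subst (λ j′ → lookup (insertAt q i a) j′ ≡ lookup (insertAt q i b) j′)
            (punchIn-punchOut (j≢i ∘ sym))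
            (trans (insertAt-punchIn q i a _) (sym (insertAt-punchIn q i b _)))

    lines-apart : {n : ℕ} (i : Fin (suc n)) {q q′ : Point n k} {x y : Point (suc n) k} →
      q ≢ q′ → x ∈ line i q → y ∈ line i q′ → ¬ AgreeOff i x y
    lines-apart i {q} {q′} q≢q′ x∈ y∈ agree with ∈-map⁻ (insertAt q i) x∈ | ∈-map⁻ (insertAt q′ i) y∈
    ... | a , _ , refl | b , _ , refl = q≢q′ (points-ext q q′ (λ j →
      trans (sym (insertAt-punchIn q i a j)) (trans (agree (punchIn i j) (punchInᵢ≢i i j)) (insertAt-punchIn q′ i b j))))

    line-length : {n : ℕ} (i : Fin (suc n)) (q : Point n k) → length (line i q) ≡ k
    line-length i q = trans (length-map (insertAt q i) (allFin k)) (length-allFin k)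

module EdgeCounts where

  open import Data.Nat using (ℕ; zero; suc; _*_; _≤_; s≤s)
  import Data.Nat.Properties
  open import Data.Nat.Combinatorics using (_C_; nC1≡n)
  open import Data.Fin using (Fin; zero; suc)
  open import Data.Fin.Properties using () renaming (_≟_ to _≟ᶠ_)
  open import Data.Vec using (lookup)
  open import Data.List using (List; []; _∷_; map; length; allFin)
  open import Data.List.Properties using (map-cong)
  open import Data.Nat.ListAction using (sum)
  open import Data.List.Membership.Propositional using (_∈_)
  open import Data.List.Relation.Unary.Any as Any using (Any; here; there)
  open import Data.List.Relation.Unary.All as All using (All; []; _∷_)
  open import Data.List.Relation.Unary.AllPairs using (_∷_)
  open import Data.List.Relation.Unary.Unique.Propositional using (Unique)
  open import Data.List.Relation.Unary.Unique.Propositional.Properties using (allFin⁺)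
  open import Data.List.Relation.Binary.Sublist.Propositional using () renaming (lookup to ⊆-lookup)
  open import Data.List.Relation.Binary.Permutation.Propositional using (_↭_)
  open import Data.List.Relation.Binary.Permutation.Propositional.Properties using (All-resp-↭; ↭-length; filter-↭)
  open import Data.Product using (_×_; _,_; proj₂)
  import Data.Bool
  open import Data.Bool.Properties using (T?)
  open import Data.Unit using (tt)
  open import Data.Empty using (⊥-elim)
  open import Relation.Nullary using (yes; no; _×-dec_)
  open import Relation.Unary using (Decidable)
  open import Relation.Binary.PropositionalEquality as ≡ using (_≡_; _≢_; refl; sym; trans; cong; subst)
  open import Function using (_∘_; _⇔_; mk⇔)
  open import Defs
  open Counting
  open Sublists
  open Binomial using (jensen)
  open Lines

  module _ {n k : ℕ} where

    InT : VSubset n k → Point n k → Set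
    InT Tset p = Data.Bool.T (Tset p)

    inT? : (Tset : VSubset n k) → Decidable (InT Tset)
    inT? Tset p = T? (Tset p)

    Collinear : Fin n → List (Point n k) → Set
    Collinear i S = All (λ p → All (AgreeOff i p) S) S

    DirEdge : ℕ → VSubset n k → Fin n → List (Point n k) → Set
    DirEdge r Tset i S = length S ≡ r × All (InT Tset) S × Collinear i S

    dirEdge? : (r : ℕ) (Tset : VSubset n k) (i : Fin n) → Decidable (DirEdge r Tset i)
    dirEdge? r Tset i S = (length S Data.Nat.≟ r) ×-dec (All.all? (inT? Tset) S ×-dec
      All.all? (λ p → All.all? (agreeOff? i p) S) S)

    direction-unique : (S : List (Point n k)) → Unique S → 2 ≤ length S →
      ∀ {i j} → Collinear i S → Collinear j S → i ≡ j
    direction-unique (_ ∷ [])    _                (s≤s ())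
    direction-unique (p ∷ q ∷ _) ((p≢q ∷ _) ∷ _) _ {i} {j} (agreeᵢ ∷ _) (agreeⱼ ∷ _) with i ≟ᶠ j
    ... | yes i≡j = i≡j
    ... | no  i≢j = ⊥-elim (p≢q (points-ext p q same))
      where
      same : ∀ l → lookup p l ≡ lookup q l
      same l with l ≟ᶠ i
      ... | yes refl = All.lookup agreeⱼ (there (here refl)) l i≢j
      ... | no  l≢i  = All.lookup agreeᵢ (there (here refl)) l l≢i

  module _ {n k : ℕ} where

    private
      K : ℕ
      K = length (allPoints n k)

    -- Within one line the direction condition is automatic, so the
    -- direction-i edges on it are the r-subsets of T ∩ line.
    line-edges : (r : ℕ) (Tset : VSubset (suc n) k) (i : Fin (suc n)) (q : Point n k) →
      subcount (dirEdge? r Tset i) (line i q) ≡ count (inT? Tset) (line i q) C r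
    line-edges r Tset i q =
      trans (count-cong (dirEdge? r Tset i) (selection? (inT? Tset) r) (sublists (line i q))
               (λ S S∈ → mk⇔ (λ (len , inT , _) → len , inT) (λ (len , inT) → len , inT , collinear S S∈)))
            (subcount-selection (inT? Tset) r (line i q))
      where
      collinear : ∀ S → S ∈ sublists (line i q) → Collinear i S
      collinear S S∈ = All.tabulate (λ x∈ → All.tabulate (λ y∈ → line-agree i q (on-line x∈) (on-line y∈)))
        where on-line : ∀ {x} → x ∈ S → x ∈ line i q
              on-line = ⊆-lookup (sublists⇒⊆ S∈)

    direction-edges : (r : ℕ) → r ≢ 0 → (Tset : VSubset (suc n) k) (i : Fin (suc n)) →
      subcount (dirEdge? r Tset i) (allPoints (suc n) k) ≡ sum (map (λ q → count (inT? Tset) (line i q) C r) (allPoints n k))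
    direction-edges r r≢0 Tset i =
      trans (subcount-↭ (dirEdge? r Tset i) reorder (allPoints-by-lines n i))
     (trans (subcount-blocks (line i) (dirEdge? r Tset i) (AgreeOff i) (λ (len , _) → r≢0 (sym len))
               (λ S (_ , _ , c) → c) (lines-apart i) (allPoints n k) (allPoints-unique n k))
            (cong sum (map-cong (line-edges r Tset i) (allPoints n k))))
      where
      reorder : ∀ {S S′} → S ↭ S′ → DirEdge r Tset i S → DirEdge r Tset i S′
      reorder σ (len , inT , c) = trans (sym (↭-length σ)) len , All-resp-↭ σ inT , All-resp-↭ σ (All.map (All-resp-↭ σ) c)

    card-by-lines : (Tset : VSubset (suc n) k) (i : Fin (suc n)) →
      card Tset ≡ sum (map (λ q → count (inT? Tset) (line i q)) (allPoints n k))
    card-by-lines Tset i = trans (↭-length (filter-↭ (inT? Tset) (allPoints-by-lines n i)))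
      (count-concatMap (inT? Tset) (line i) (allPoints n k))

    -- For r ≥ 2 every edge lies on a line of exactly one direction.
    edges-by-direction : (r : ℕ) → 2 ≤ r → (Tset : VSubset (suc n) k) →
      eInduced (suc n) k r Tset ≡ sum (map (λ i → subcount (dirEdge? r Tset i) (allPoints (suc n) k)) (allFin (suc n)))
    edges-by-direction r 2≤r Tset =
      count-Σ (dirEdge? r Tset) (isEdgeIn? r Tset) points (allFin (suc n)) (allFin⁺ (suc n)) (λ S _ → by-direction S) unique-direction
      where
      points : List (List (Point (suc n) k))
      points = sublists (allPoints (suc n) k)
      by-direction : ∀ S → IsEdgeIn r Tset S ⇔ Any (λ i → DirEdge r Tset i S) (allFin (suc n))
      by-direction S = mk⇔ split join
        where
        split : IsEdgeIn r Tset S → Any (λ i → DirEdge r Tset i S) (allFin (suc n))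
        split (len , inT , axis) = Any.map (λ c → len , inT , c) axis
        join : Any (λ i → DirEdge r Tset i S) (allFin (suc n)) → IsEdgeIn r Tset S
        join d with Any.satisfied d
        ... | _ , len , inT , _ = len , inT , Any.map (proj₂ ∘ proj₂) d
      unique-direction : ∀ S → S ∈ points → ∀ i j → DirEdge r Tset i S → DirEdge r Tset j S → i ≡ j
      unique-direction S S∈ i j (len , _ , cᵢ) (_ , _ , cⱼ) =
        direction-unique S (unique-⊆ (sublists⇒⊆ S∈) (allPoints-unique (suc n) k)) (subst (2 ≤_) (sym len) 2≤r) cᵢ cⱼ

    edges-singletons : (Tset : VSubset (suc n) k) → eInduced (suc n) k 1 Tset ≡ card Tset
    edges-singletons Tset =
      trans (count-cong (isEdgeIn? 1 Tset) (selection? (inT? Tset) 1) (sublists (allPoints (suc n) k))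
               (λ S _ → mk⇔ (λ (len , inT , _) → len , inT) (singleton-edge S)))
     (trans (subcount-selection (inT? Tset) 1 (allPoints (suc n) k)) (nC1≡n (card Tset)))
      where
      singleton-edge : ∀ S → Selection (inT? Tset) 1 S → IsEdgeIn 1 Tset S
      singleton-edge (p ∷ []) (len , inT) = len , inT , here (((λ _ _ → refl) ∷ []) ∷ [])

    full-line : (i : Fin (suc n)) (q : Point n k) → count (inT? full) (line i q) ≡ k
    full-line i q = trans (count-all (inT? full) (line i q) (λ _ → tt)) (line-length i q)

    card-full : card {suc n} {k} full ≡ K * k
    card-full = trans (card-by-lines full zero) (sum-map-const _ k (allPoints n k) (full-line zero))

    edges-full : (r : ℕ) → 2 ≤ r → eF (suc n) k r ≡ suc n * (K * (k C r))
    edges-full r@(suc r′) 2≤r = begin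
      eF (suc n) k r
        ≡⟨ edges-by-direction r 2≤r full ⟩
      sum (map (λ i → subcount (dirEdge? r full i) (allPoints (suc n) k)) (allFin (suc n)))
        ≡⟨ sum-map-const _ _ (allFin (suc n)) (λ i → trans (direction-edges r (λ ()) full i)
             (sum-map-const _ _ (allPoints n k) (λ q → cong (_C r) (full-line i q)))) ⟩
      length (allFin (suc n)) * (K * (k C r))
        ≡⟨ cong (_* (K * (k C r))) (length-allFin (suc n)) ⟩
      suc n * (K * (k C r)) ∎
      where open ≡.≡-Reasoning

    -- If |T| ≥ K·m then e(F[T]) ≥ n·K·C(m, r) for r ≥ 2: by convexity each
    -- direction contributes at least K·C(m, r).
    edges-lower : (r : ℕ) → 2 ≤ r → (Tset : VSubset (suc n) k) (m : ℕ) → K * m ≤ card Tset →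
      suc n * (K * (m C r)) ≤ eInduced (suc n) k r Tset
    edges-lower r@(suc s) 2≤r Tset m avg = begin
      suc n * (K * (m C r))
        ≡⟨ cong (_* (K * (m C r))) (sym (length-allFin (suc n))) ⟩
      length (allFin (suc n)) * (K * (m C r))
        ≤⟨ sum-map-lower _ _ (allFin (suc n)) per-direction ⟩
      sum (map (λ i → subcount (dirEdge? r Tset i) (allPoints (suc n) k)) (allFin (suc n)))
        ≡⟨ sym (edges-by-direction r 2≤r Tset) ⟩
      eInduced (suc n) k r Tset ∎
      where
      open Data.Nat.Properties.≤-Reasoning
      per-direction : ∀ i → K * (m C r) ≤ subcount (dirEdge? r Tset i) (allPoints (suc n) k)
      per-direction i = Data.Nat.Properties.≤-trans
        (jensen (λ q → count (inT? Tset) (line i q)) (allPoints n k) m s (subst (K * m ≤_) (card-by-lines Tset i) avg))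
        (Data.Nat.Properties.≤-reflexive (sym (direction-edges r (λ ()) Tset i)))

module Rationals where

  open import Data.Nat as ℕ using (ℕ; zero; suc)
  import Data.Nat.Properties as ℕ
  open import Data.Integer as ℤ using (+_; +≤+; +<+)
  import Data.Integer.Properties as ℤ
  open import Data.Rational
  open import Data.Rational.Properties
  import Data.Rational.Unnormalised as U
  import Data.Rational.Unnormalised.Properties as U
  open import Data.Rational.Solver using (module +-*-Solver)
  open import Data.Nat.Coprimality using (1-coprimeTo) renaming (sym to coprime-sym)
  open import Relation.Binary.PropositionalEquality using (_≡_; refl; sym; trans; cong; cong₂; subst₂)
  open import Relation.Binary.Definitions using (tri<; tri≈; tri>)
  open import Data.Empty using (⊥-elim)
  open import Defs using (_^ℚ_)
  open +-*-Solver using (solve; _:+_; _:-_; _:*_; _:=_)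

  ι : ℕ → ℚ
  ι a = (+ a) / 1

  private
    ι-normal : (a : ℕ) → ι a ≡ mkℚ (+ a) 0 (coprime-sym (1-coprimeTo a))
    ι-normal a = normalize-coprime (coprime-sym (1-coprimeTo a))

    toℚᵘ-ι : (a : ℕ) → toℚᵘ (ι a) U.≃ U.mkℚᵘ (+ a) 0
    toℚᵘ-ι a = toℚᵘ-fromℚᵘ (U.mkℚᵘ (+ a) 0)

  ι-mono-≤ : {a b : ℕ} → a ℕ.≤ b → ι a ≤ ι b
  ι-mono-≤ {a} {b} a≤b rewrite ι-normal a | ι-normal b =
    *≤* (subst₂ ℤ._≤_ (sym (ℤ.*-identityʳ (+ a))) (sym (ℤ.*-identityʳ (+ b))) (+≤+ a≤b))

  ι-mono-< : {a b : ℕ} → a ℕ.< b → ι a < ι b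
  ι-mono-< {a} {b} a<b rewrite ι-normal a | ι-normal b =
    *<* (subst₂ ℤ._<_ (sym (ℤ.*-identityʳ (+ a))) (sym (ℤ.*-identityʳ (+ b))) (+<+ a<b))

  ι-cancel-< : {a b : ℕ} → ι a < ι b → a ℕ.< b
  ι-cancel-< {a} {b} ιa<ιb with ℕ.<-cmp a b
  ... | tri< a<b _ _ = a<b
  ... | tri≈ _ refl _ = ⊥-elim (<-irrefl refl ιa<ιb)
  ... | tri> _ _ b<a = ⊥-elim (<-asym ιa<ιb (ι-mono-< b<a))

  ι-nonNeg : (a : ℕ) → 0ℚ ≤ ι a
  ι-nonNeg a = ι-mono-≤ {0} {a} ℕ.z≤n

  ι-pos : (a : ℕ) .{{_ : ℕ.NonZero a}} → Positive (ι a)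
  ι-pos (suc a) = positive (ι-mono-< {0} {suc a} (ℕ.s≤s ℕ.z≤n))

  ι-+ : (a b : ℕ) → ι (a ℕ.+ b) ≡ ι a + ι b
  ι-+ a b = toℚᵘ-injective (U.≃-trans (toℚᵘ-ι (a ℕ.+ b)) (U.≃-sym (U.≃-trans (toℚᵘ-homo-+ (ι a) (ι b))
    (U.≃-trans (U.+-cong (toℚᵘ-ι a) (toℚᵘ-ι b))
      (U.*≡* (cong (ℤ._* + 1) (trans (cong₂ ℤ._+_ (ℤ.*-identityʳ (+ a)) (ℤ.*-identityʳ (+ b))) (sym (ℤ.pos-+ a b)))))))))

  ι-* : (a b : ℕ) → ι (a ℕ.* b) ≡ ι a * ι b
  ι-* a b = toℚᵘ-injective (U.≃-trans (toℚᵘ-ι (a ℕ.* b)) (U.≃-sym (U.≃-trans (toℚᵘ-homo-* (ι a) (ι b))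
    (U.≃-trans (U.*-cong (toℚᵘ-ι a) (toℚᵘ-ι b)) (U.*≡* (cong (ℤ._* + 1) (sym (ℤ.pos-* a b))))))))

  ι-^ : (a r : ℕ) → ι (a ℕ.^ r) ≡ ι a ^ℚ r
  ι-^ a zero    = refl
  ι-^ a (suc r) = trans (ι-* a (a ℕ.^ r)) (cong (ι a *_) (ι-^ a r))

  /-ι : (a k : ℕ) .{{_ : ℕ.NonZero k}} → ((+ a) / k) * ι k ≡ ι a
  /-ι a (suc k) = toℚᵘ-injective (U.≃-trans (toℚᵘ-homo-* ((+ a) / suc k) (ι (suc k)))
    (U.≃-trans (U.*-cong (toℚᵘ-fromℚᵘ (U.mkℚᵘ (+ a) k)) (toℚᵘ-ι (suc k)))
      (U.≃-trans (U.*≡* cross) (U.≃-sym (toℚᵘ-ι a)))))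
    where
    cross : (+ a ℤ.* + suc k) ℤ.* + 1 ≡ + a ℤ.* + suc (k ℕ.* 1)
    cross = trans (ℤ.*-identityʳ _) (cong (λ x → + a ℤ.* + suc x) (sym (ℕ.*-identityʳ k)))

  /-monoˡ-≤ : {a b : ℕ} (k : ℕ) .{{_ : ℕ.NonZero k}} → a ℕ.≤ b → (+ a) / k ≤ (+ b) / k
  /-monoˡ-≤ {a} {b} k a≤b = *-cancelʳ-≤-pos (ι k) {{ι-pos k}}
    (subst₂ _≤_ (sym (/-ι a k)) (sym (/-ι b k)) (ι-mono-≤ a≤b))

  ^ℚ-* : (a b : ℚ) (r : ℕ) → (a * b) ^ℚ r ≡ (a ^ℚ r) * (b ^ℚ r)
  ^ℚ-* a b zero    = refl
  ^ℚ-* a b (suc r) = trans (cong ((a * b) *_) (^ℚ-* a b r))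
    (solve 4 (λ a b x y → (a :* b) :* (x :* y) := (a :* x) :* (b :* y)) refl a b (a ^ℚ r) (b ^ℚ r))

  ^ℚ-nonNeg : (a : ℚ) (r : ℕ) → 0ℚ ≤ a → 0ℚ ≤ a ^ℚ r
  ^ℚ-nonNeg a zero    _   = ι-nonNeg 1
  ^ℚ-nonNeg a (suc r) 0≤a = nonNegative⁻¹ _
    {{nonNeg*nonNeg⇒nonNeg a {{nonNegative 0≤a}} (a ^ℚ r) {{nonNegative (^ℚ-nonNeg a r 0≤a)}}}}

  ^ℚ-mono : (a b : ℚ) (r : ℕ) → 0ℚ ≤ a → a ≤ b → a ^ℚ r ≤ b ^ℚ r
  ^ℚ-mono a b zero    _   _   = ≤-refl
  ^ℚ-mono a b (suc r) 0≤a a≤b =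
    ≤-trans (*-monoʳ-≤-nonNeg (a ^ℚ r) {{nonNegative (^ℚ-nonNeg a r 0≤a)}} a≤b)
            (*-monoˡ-≤-nonNeg b {{nonNegative (≤-trans 0≤a a≤b)}} (^ℚ-mono a b r 0≤a a≤b))

  +-cancelʳ-≤′ : (a b c : ℚ) → a + c ≤ b + c → a ≤ b
  +-cancelʳ-≤′ a b c le = subst₂ _≤_ (drop a) (drop b) (+-monoˡ-≤ (- c) le)
    where drop : ∀ x → (x + c) + - c ≡ x
          drop x = solve 2 (λ x c → (x :+ c) :- c := x) refl x c

  scaled-power-bound : (x : ℚ) (M F E k r : ℕ) .{{_ : ℕ.NonZero k}} →
    0ℚ ≤ x → x * ι k ≤ ι M → M ℕ.^ r ℕ.* F ℕ.≤ E ℕ.* k ℕ.^ r → (x ^ℚ r) * ι F ≤ ι E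
  scaled-power-bound x M F E k r 0≤x xk≤M nat =
    *-cancelʳ-≤-pos (ι (k ℕ.^ r)) {{ι-pos (k ℕ.^ r) {{ℕ.m^n≢0 k r}}}} (begin
      ((x ^ℚ r) * ι F) * ι (k ℕ.^ r)   ≡⟨ solve 3 (λ a b c → (a :* b) :* c := (a :* c) :* b) refl (x ^ℚ r) (ι F) (ι (k ℕ.^ r)) ⟩
      ((x ^ℚ r) * ι (k ℕ.^ r)) * ι F   ≡⟨ cong (λ t → ((x ^ℚ r) * t) * ι F) (ι-^ k r) ⟩
      ((x ^ℚ r) * (ι k ^ℚ r)) * ι F    ≡⟨ cong (_* ι F) (sym (^ℚ-* x (ι k) r)) ⟩
      ((x * ι k) ^ℚ r) * ι F           ≤⟨ *-monoʳ-≤-nonNeg (ι F) {{nonNegative (ι-nonNeg F)}} (^ℚ-mono (x * ι k) (ι M) r 0≤xk xk≤M) ⟩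
      (ι M ^ℚ r) * ι F                 ≡⟨ cong (_* ι F) (sym (ι-^ M r)) ⟩
      ι (M ℕ.^ r) * ι F                ≡⟨ sym (ι-* (M ℕ.^ r) F) ⟩
      ι (M ℕ.^ r ℕ.* F)                ≤⟨ ι-mono-≤ nat ⟩
      ι (E ℕ.* k ℕ.^ r)                ≡⟨ ι-* E (k ℕ.^ r) ⟩
      ι E * ι (k ℕ.^ r)                ∎)
    where
    open ≤-Reasoning
    0≤xk : 0ℚ ≤ x * ι k
    0≤xk = nonNegative⁻¹ _ {{nonNeg*nonNeg⇒nonNeg x {{nonNegative 0≤x}} (ι k) {{nonNegative (ι-nonNeg k)}}}}

module NaturalCore where

  open import Data.Nat using (ℕ; suc; _+_; _*_; _∸_; _^_; _≤_; s≤s; z≤n; NonZero)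
  open import Data.Nat.Properties using (*-monoʳ-≤; *-monoˡ-≤; module ≤-Reasoning)
  open import Data.Nat.Combinatorics using (_C_)
  open import Data.Nat.Tactic.RingSolver using (solve-∀)
  open import Data.List using (length)
  open import Relation.Binary.PropositionalEquality using (_≡_; sym; cong; trans)
  open import Defs
  open EdgeCounts using (edges-singletons; card-full; edges-full; edges-lower)
  open Binomial using (binomial-ratio)
  open ≤-Reasoning

  edge-inequality : (n k r : ℕ) .{{_ : NonZero r}} (Tset : VSubset (suc n) k) (m : ℕ) →
    length (allPoints n k) * m ≤ card Tset →
    (suc m ∸ r) ^ r * eF (suc n) k r ≤ eInduced (suc n) k r Tset * k ^ r
  edge-inequality n k 1 Tset m avg = begin
    m * 1 * eF (suc n) k 1          ≡⟨ cong (m * 1 *_) (trans (edges-singletons {n} {k} full) (card-full {n} {k})) ⟩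
    m * 1 * (K * k)                  ≡⟨ regroup m K k ⟩
    (K * m) * (k * 1)                ≤⟨ *-monoˡ-≤ (k * 1) avg ⟩
    card Tset * (k * 1)              ≡⟨ cong (_* (k * 1)) (sym (edges-singletons {n} {k} Tset)) ⟩
    eInduced (suc n) k 1 Tset * (k * 1) ∎
    where K : ℕ
          K = length (allPoints n k)
          regroup : ∀ m K k → m * 1 * (K * k) ≡ (K * m) * (k * 1)
          regroup = solve-∀
  edge-inequality n k r@(suc (suc s)) Tset m avg = begin
    M ^ r * eF (suc n) k r                ≡⟨ cong (M ^ r *_) (edges-full {n} {k} r 2≤r) ⟩
    M ^ r * (suc n * (K * (k C r)))       ≡⟨ regroup₁ (M ^ r) (suc n) K (k C r) ⟩
    (suc n * K) * ((k C r) * M ^ r)       ≤⟨ *-monoʳ-≤ (suc n * K) (binomial-ratio r m k) ⟩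
    (suc n * K) * ((m C r) * k ^ r)       ≡⟨ regroup₂ (suc n) K (m C r) (k ^ r) ⟩
    suc n * (K * (m C r)) * k ^ r         ≤⟨ *-monoˡ-≤ (k ^ r) (edges-lower {n} {k} r 2≤r Tset m avg) ⟩
    eInduced (suc n) k r Tset * k ^ r     ∎
    where K M : ℕ
          K = length (allPoints n k)
          M = suc m ∸ r
          2≤r : 2 ≤ r
          2≤r = s≤s (s≤s z≤n)
          regroup₁ : ∀ a n K c → a * (n * (K * c)) ≡ (n * K) * (c * a)
          regroup₁ = solve-∀
          regroup₂ : ∀ n K c p → (n * K) * (c * p) ≡ n * (K * c) * p
          regroup₂ = solve-∀

module Density where

  open import Data.Nat as ℕ using (ℕ; suc; NonZero)
  import Data.Nat.Properties as ℕ
  open import Data.Nat.DivMod using (m≡m%n+[m/n]*n; m%n<n; m/n*n≤m) renaming (_/_ to _div_)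
  open import Data.Integer using (+_)
  open import Data.Rational using (ℚ; 0ℚ; _/_; _+_; _-_; _*_; _≤_; _<_; nonNegative)
  open import Data.Rational.Properties using (≤-<-trans; <-trans; <⇒≤; +-monoˡ-≤; *-cancelʳ-<-nonNeg)
  open import Data.Rational.Solver using (module +-*-Solver)
  open import Data.Product using (_×_; _,_)
  open import Relation.Binary.PropositionalEquality using (_≡_; refl; sym; trans; cong; subst; subst₂)
  open Rationals
  open +-*-Solver using (solve; _:+_; _:-_; _:*_; _:=_)

  floor-bounds : (c K : ℕ) .{{_ : NonZero K}} → K ℕ.* (c div K) ℕ.≤ c × c ℕ.< suc (c div K) ℕ.* K
  floor-bounds c K =
    subst (ℕ._≤ c) (ℕ.*-comm (c div K) K) (m/n*n≤m c K) ,
    subst (ℕ._< suc (c div K) ℕ.* K) (sym (m≡m%n+[m/n]*n c K)) (ℕ.+-monoˡ-< ((c div K) ℕ.* K) (m%n<n c K))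

  density-bound : (γ : ℚ) (r k K c : ℕ) .{{_ : NonZero k}} .{{_ : NonZero K}} →
    (+ r) / k ≤ γ → γ * ι (K ℕ.* k) < ι c →
    0ℚ ≤ γ - (+ r) / k × (γ - (+ r) / k) * ι k ≤ ι (suc (c div K) ℕ.∸ r)
  density-bound γ r k K c d≤γ dense = 0≤x , xk≤M
    where
    d x : ℚ
    d = (+ r) / k
    x = γ - d
    m M : ℕ
    m = c div K
    M = suc m ℕ.∸ r

    0≤x : 0ℚ ≤ x
    0≤x = +-cancelʳ-≤′ 0ℚ x d 
      (subst₂ _≤_ (sym (Data.Rational.Properties.+-identityˡ d)) (solve 2 (λ γ d → γ := (γ :- d) :+ d) refl γ d) d≤γ)

    xk+r : x * ι k + ι r ≡ γ * ι k
    xk+r = trans (cong (λ t → x * ι k + t) (sym (/-ι r k))) (solve 3 (λ γ d k → (γ :- d) :* k :+ d :* k := γ :* k) refl γ d (ι k))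

    -- γ·k < m + 1, since γ·k·K < c < (m+1)·K
    γk<m+1 : γ * ι k < ι (suc m)
    γk<m+1 = *-cancelʳ-<-nonNeg (ι K) {{nonNegative (ι-nonNeg K)}} (subst₂ _<_ lhs (ι-* (suc m) K)
      (<-trans dense (ι-mono-< (Data.Product.proj₂ (floor-bounds c K)))))
      where lhs : γ * ι (K ℕ.* k) ≡ (γ * ι k) * ι K
            lhs = trans (cong (γ *_) (ι-* K k)) (solve 3 (λ γ K k → γ :* (K :* k) := (γ :* k) :* K) refl γ (ι K) (ι k))

    xk+r<m+1 : x * ι k + ι r < ι (suc m)
    xk+r<m+1 = subst (_< ι (suc m)) (sym xk+r) γk<m+1

    0≤xk : 0ℚ ≤ x * ι k
    0≤xk = Data.Rational.Properties.nonNegative⁻¹ _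
      {{Data.Rational.Properties.nonNeg*nonNeg⇒nonNeg x {{nonNegative 0≤x}} (ι k) {{nonNegative (ι-nonNeg k)}}}}

    r<m+1 : r ℕ.< suc m
    r<m+1 = ι-cancel-< (≤-<-trans (subst (_≤ x * ι k + ι r) (Data.Rational.Properties.+-identityˡ (ι r)) (+-monoˡ-≤ (ι r) 0≤xk)) xk+r<m+1)

    xk≤M : x * ι k ≤ ι M
    xk≤M = +-cancelʳ-≤′ (x * ι k) (ι M) (ι r)
      (<⇒≤ (subst (x * ι k + ι r <_) (trans (cong ι (sym (ℕ.m∸n+n≡m (ℕ.<⇒≤ r<m+1)))) (ι-+ M r)) xk+r<m+1))

open import Defs
open import Data.Nat using (ℕ; _≤_; NonZero)
open import Data.Integer using (+_)
open import Data.Rational using (ℚ; _/_; _<_; _-_; _*_; _≤_)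

open import Data.Nat using (suc; _∸_)
open import Data.Rational using (0ℚ)
open import Data.Nat.Properties using (m≤n*m; m^n≢0)
open import Data.Nat.DivMod using () renaming (_/_ to _div_)
open import Data.Rational.Properties using (≤-<-trans; <⇒≤)
open import Data.List using (length)
open import Data.Product using (_×_; proj₁; proj₂)
open import Relation.Binary.PropositionalEquality using (sym; subst)
open Lines using (length-allPoints)
open EdgeCounts using (card-full)
open Rationals using (ι; /-monoˡ-≤; scaled-power-bound)
open NaturalCore using (edge-inequality)
open Density using (floor-bounds; density-bound)

lemma7p1 : (n k r : ℕ) → .{{_ : NonZero n}} → .{{_ : NonZero k}} → .{{_ : NonZero r}} →
    r Data.Nat.≤ k →
    (γ : ℚ) → ((+ (10 Data.Nat.* r)) / k) < γ →
    (Tset : VSubset n k) →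
    γ * ((+ card {n} {k} full) / 1) < (+ card Tset) / 1 →
    ((γ - (+ r) / k) ^ℚ r) * ((+ eF n k r) / 1) Data.Rational.≤ (+ eInduced n k r Tset) / 1
lemma7p1 (suc n) k r _ γ above-10r/k Tset dense =
  scaled-power-bound x (suc m ∸ r) (eF (suc n) k r) (eInduced (suc n) k r Tset) k r (proj₁ bounds) (proj₂ bounds) core
  where
  x : ℚ
  x = γ - (+ r) / k
  -- K = k^(n-1) lines in each direction
  K : ℕ
  K = length (allPoints n k)
  instance
    K≢0 : NonZero K
    K≢0 = subst NonZero (sym (length-allPoints n k)) (m^n≢0 k n)
  m : ℕ
  m = card Tset div K
  core : (suc m ∸ r) Data.Nat.^ r Data.Nat.* eF (suc n) k r Data.Nat.≤ eInduced (suc n) k r Tset Data.Nat.* k Data.Nat.^ r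
  core = edge-inequality n k r Tset m (proj₁ (floor-bounds (card Tset) K))
  r/k≤γ : (+ r) / k Data.Rational.≤ γ
  r/k≤γ = <⇒≤ (≤-<-trans (/-monoˡ-≤ k (m≤n*m r 10)) above-10r/k)
  bounds : 0ℚ Data.Rational.≤ x × x * ι k Data.Rational.≤ ι (suc m ∸ r)
  bounds = density-bound γ r k K (card Tset) r/k≤γ (subst (λ v → γ * ι v < ι (card Tset)) (card-full {n} {k}) dense)
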